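{- Let $G$ be a complete graph with $n$ vertices and let $f_0$ and $f_t$ be initial and target token-placements of $G$. Then $\mathrm{OPT}(f_0,f_t)\ge n-|\mathcal{C}^*(f_0,f_t)|$, where $\mathcal{C}^*(f_0,f_t)$ is an optimal cycle cover of the destination graph $D(f_0,f_t)$.
   Context: Colors are $\{1,\dots,c\}$; a token-placement of $G=(V,E)$ is a surjective map $V\to\{1,\dots,c\}$. A swap along an edge $(u,v)$ exchanges the values at $u$ and $v$; $\mathrm{OPT}(f,f')$ is the minimum number of swaps transforming $f$ into $f'$. The destination graph $D(f_0,f_t)$ is the directed graph on $V$ with an arc $(u,v)$ (self-loops allowed) iff $f_0(u)=f_t(v)$. A cycle cover is a set of vertex-disjoint directed cycles of $D(f_0,f_t)$ (self-loops count as one-vertex cycles) covering all vertices; it is optimal if it has the maximum number of cycles among all cycle covers. -}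

module Defs where

open import Data.Nat using (ℕ; _≤_)
open import Data.Fin using (Fin; _≟_)
open import Data.Fin.Properties using ()
open import Data.List using (List; []; _∷_; length; concat; foldl)
open import Data.List.Relation.Unary.All using (All)
open import Data.List.Relation.Binary.Permutation.Propositional using (_↭_)
open import Data.Fin.Base using ()
open import Data.List.Base using ()
open import Data.Product using (Σ; ∃; _×_)
open import Data.Unit using (⊤)
open import Data.Empty using (⊥)
open import Relation.Nullary using (¬_; yes; no)
open import Relation.Binary.PropositionalEquality using (_≡_)

open import Data.List using (allFin) public

-- Colours {1,…,c} are modelled as Fin c; vertices of G as Fin n.
-- A token-placement is a surjective map from vertices to colours.
Placement : ℕ → ℕ → Set
Placement n c = Fin n → Fin c

IsSurjective : ∀ {n c} → Placement n c → Set
IsSurjective {n} {c} f = (y : Fin c) → ∃ λ (x : Fin n) → f x ≡ y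

-- Edges of the complete (simple) graph K_n: unordered pairs of distinct
-- vertices, represented as ordered pairs (u , v) with u ≢ v.
Edge : ℕ → Set
Edge n = Σ (Fin n) λ u → Σ (Fin n) λ v → ¬ (u ≡ v)

swapAt : ∀ {n c} → Placement n c → Fin n → Fin n → Placement n c
swapAt f u v w with w ≟ u
... | yes _ = f v
... | no _ with w ≟ v
...   | yes _ = f u
...   | no _ = f w

applySwap : ∀ {n c} → Placement n c → Edge n → Placement n c
applySwap f (u Data.Product., v Data.Product., _) = swapAt f u v

applySwaps : ∀ {n c} → Placement n c → List (Edge n) → Placement n c
applySwaps f [] = f
applySwaps f (e ∷ es) = applySwaps (applySwap f e) es

ReachableIn : ∀ {n c} → Placement n c → Placement n c → ℕ → Set
ReachableIn {n} f f' k =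
  Σ (List (Edge n)) λ es → (length es ≡ k) × (∀ w → applySwaps f es w ≡ f' w)

IsOPT : ∀ {n c} → Placement n c → Placement n c → ℕ → Set
IsOPT f f' k = ReachableIn f f' k × (∀ m → ReachableIn f f' m → k ≤ m)

Arc : ∀ {n c} → Placement n c → Placement n c → Fin n → Fin n → Set
Arc f0 ft u v = f0 u ≡ ft v

-- Closes f0 ft x0 prev ys : the walk prev → ys … → x0 follows arcs of D
Closes : ∀ {n c} → Placement n c → Placement n c → Fin n → Fin n → List (Fin n) → Set
Closes f0 ft x0 prev [] = Arc f0 ft prev x0
Closes f0 ft x0 prev (y ∷ ys) = Arc f0 ft prev y × Closes f0 ft x0 y ys

-- A directed cycle x₀ → x₁ → … → x_k → x₀ of D, listed as [x₀,…,x_k]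
-- (a single vertex [x] is a self-loop).  Distinctness of its vertices is
-- enforced by the covering condition in CycleCover.
IsCycle : ∀ {n c} → Placement n c → Placement n c → List (Fin n) → Set
IsCycle f0 ft [] = ⊥
IsCycle f0 ft (x ∷ xs) = Closes f0 ft x x xs

-- A cycle cover: a collection of directed cycles of D whose vertex lists
-- together list every vertex exactly once (vertex-disjoint, covering).
record CycleCover {n c} (f0 ft : Placement n c) : Set where
  field
    cycles : List (List (Fin n))
    areCycles : All (IsCycle f0 ft) cycles
    partition : concat cycles ↭ allFin n

numCycles : ∀ {n c} {f0 ft : Placement n c} → CycleCover f0 ft → ℕ
numCycles C = length (CycleCover.cycles C)

IsOptimal : ∀ {n c} {f0 ft : Placement n c} → CycleCover f0 ft → Set
IsOptimal {f0 = f0} {ft} C = (C' : CycleCover f0 ft) → numCycles C' ≤ numCycles C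

-- Swapping the tokens at a and b changes the destination graph only in the arcs
-- leaving a and b: the arc of D(swapAt f a b, ft) out of a is an arc of D(f, ft)
-- out of b and vice versa.  So from a cycle cover of D(swapAt f a b, ft) one gets
-- a cover of D(f, ft) by exchanging the successors of a and b, which splits the
-- cycle through a and b into two, or merges the two cycles through them into one;
-- either way at most one cycle is lost.  Undoing k swaps one at a time, starting
-- from the cover of D(ft, ft) by its n self-loops, yields a cover of D(f0, ft)
-- with at least n − k cycles, and an optimal cover has at least as many.
module Submission where

open import Defs
open import Data.Nat using (ℕ; suc; _≤_; _+_; _∸_)
open import Data.Nat.Properties
  using (module ≤-Reasoning; ≤-trans; ≤-reflexive; n≤1+n; +-suc; +-comm; +-monoʳ-≤; m≤n+o⇒m∸n≤o)
open import Data.Fin using (Fin; _≟_)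
open import Data.List using (List; []; _∷_; _++_; length; concat; map; [_])
open import Data.List.Properties using (++-assoc; ++-identityʳ; length-map; length-tabulate)
open import Data.List.Relation.Unary.All using (All; []; _∷_; zipWith)
import Data.List.Relation.Unary.All.Properties as All
open import Data.List.Relation.Unary.Any using (here; there)
open import Data.List.Relation.Unary.Unique.Propositional using (Unique; _∷_)
open import Data.List.Relation.Unary.Unique.Propositional.Properties using (allFin⁺)
open import Data.List.Membership.Propositional using (_∈_)
open import Data.List.Membership.Propositional.Properties using (∈-allFin; ∈-∃++; ∈-++⁻; ∈-concat⁻′)
open import Data.List.Relation.Binary.Permutation.Propositional as ↭
  using (_↭_; prep; ↭-refl; ↭-sym; ↭-trans; ↭-reflexive; ↭⇒↭ₛ; module PermutationReasoning)
open import Data.List.Relation.Binary.Permutation.Propositional.Properties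
  using (shift; shifts; ++-comm; ++⁺ˡ; ++⁺ʳ; ∈-resp-↭; All-resp-↭; ↭-length)
import Data.List.Relation.Binary.Permutation.Setoid.Properties as Permₛ
open import Data.Product using (Σ; _×_; _,_)
open import Data.Sum using (inj₁; inj₂)
open import Data.Empty using (⊥-elim)
open import Relation.Nullary using (yes; no)
open import Relation.Binary.PropositionalEquality using (_≡_; _≢_; refl; sym; trans; cong; subst; setoid)

Unique-resp-↭ : ∀ {A : Set} {xs ys : List A} → xs ↭ ys → Unique xs → Unique ys
Unique-resp-↭ p = Permₛ.Unique-resp-↭ (setoid _) (↭⇒↭ₛ p)

concat-↭ : ∀ {A : Set} {xss yss : List (List A)} → xss ↭ yss → concat xss ↭ concat yss
concat-↭ ↭.refl = ↭-refl
concat-↭ (↭.prep xs p) = ++⁺ˡ xs (concat-↭ p)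
concat-↭ (↭.swap xs ys p) = ↭-trans (++⁺ˡ xs (++⁺ˡ ys (concat-↭ p))) (shifts xs ys)
concat-↭ (↭.trans p q) = ↭-trans (concat-↭ p) (concat-↭ q)

∈⇒↭-∷ : ∀ {A : Set} {x : A} {xs} → x ∈ xs → Σ (List A) λ ys → xs ↭ x ∷ ys
∈⇒↭-∷ x∈xs with ∈-∃++ x∈xs
... | ys , zs , refl = ys ++ zs , shift _ ys zs

rotate-↭ : ∀ {A : Set} (xs : List A) y zs → xs ++ y ∷ zs ↭ y ∷ zs ++ xs
rotate-↭ xs y zs = ↭-trans (shift y xs zs) (prep y (++-comm xs zs))

exchange-↭ : ∀ {A : Set} (x : A) xs ys zs → xs ++ x ∷ ys ++ zs ↭ ys ++ x ∷ xs ++ zs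
exchange-↭ x xs ys zs = begin
  xs ++ x ∷ ys ++ zs  ↭⟨ shift x xs (ys ++ zs) ⟩
  x ∷ xs ++ ys ++ zs  ↭⟨ prep x (shifts xs ys) ⟩
  x ∷ ys ++ xs ++ zs  ↭⟨ ↭-sym (shift x ys (xs ++ zs)) ⟩
  ys ++ x ∷ xs ++ zs  ∎
  where open PermutationReasoning

swapAt-left : ∀ {n c} (f : Placement n c) u v → swapAt f u v u ≡ f v
swapAt-left f u v with u ≟ u
... | yes _ = refl
... | no u≢u = ⊥-elim (u≢u refl)

swapAt-right : ∀ {n c} (f : Placement n c) {u v} → u ≢ v → swapAt f u v v ≡ f u
swapAt-right f {u} {v} u≢v with v ≟ u
... | yes v≡u = ⊥-elim (u≢v (sym v≡u))
... | no _ with v ≟ v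
...   | yes _ = refl
...   | no v≢v = ⊥-elim (v≢v refl)

swapAt-other : ∀ {n c} (f : Placement n c) {u v w} → u ≢ w → v ≢ w → swapAt f u v w ≡ f w
swapAt-other f {u} {v} {w} u≢w v≢w with w ≟ u
... | yes w≡u = ⊥-elim (u≢w (sym w≡u))
... | no _ with w ≟ v
...   | yes w≡v = ⊥-elim (v≢w (sym w≡v))
...   | no _ = refl

module _ {n c : ℕ} {f ft : Placement n c} where

  Closes-++⁻ : ∀ {t s} ys {m} zs → Closes f ft t s (ys ++ m ∷ zs) →
    Closes f ft m s ys × Closes f ft t m zs
  Closes-++⁻ [] zs (s→m , rest) = s→m , rest
  Closes-++⁻ (y ∷ ys) zs (s→y , rest) with Closes-++⁻ ys zs rest
  ... | left , right = (s→y , left) , right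

  Closes-++⁺ : ∀ {t s} ys {m} zs → Closes f ft m s ys → Closes f ft t m zs →
    Closes f ft t s (ys ++ m ∷ zs)
  Closes-++⁺ [] zs s→m right = s→m , right
  Closes-++⁺ (y ∷ ys) zs (s→y , left) right = s→y , Closes-++⁺ ys zs left right

  IsCycle-rotate : ∀ xs {y} zs → IsCycle f ft (xs ++ y ∷ zs) → IsCycle f ft (y ∷ zs ++ xs)
  IsCycle-rotate [] {y} zs cyc = subst (Closes f ft y y) (sym (++-identityʳ zs)) cyc
  IsCycle-rotate (x ∷ xs) zs cyc with Closes-++⁻ xs zs cyc
  ... | x→y , y→x = Closes-++⁺ zs xs y→x x→y

  record CycleThrough (x : Fin n) (L : List (List (Fin n))) : Set where
    constructor cycleThrough
    field
      path : List (Fin n)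
      others : List (List (Fin n))
      isCycle : IsCycle f ft (x ∷ path)
      othersAreCycles : All (IsCycle f ft) others
      split : concat L ↭ x ∷ path ++ concat others
      count : length L ≡ suc (length others)

  cycle-through : ∀ {x} L → All (IsCycle f ft) L → x ∈ concat L → CycleThrough x L
  cycle-through {x} L cycs x∈L with ∈-concat⁻′ L x∈L
  ... | C , x∈C , C∈L with ∈⇒↭-∷ C∈L | ∈-∃++ x∈C
  ...   | R , L↭C∷R | xs , zs , refl with All-resp-↭ L↭C∷R cycs
  ...     | cyc ∷ cycsR = cycleThrough (zs ++ xs) R (IsCycle-rotate xs zs cyc) cycsR
    (↭-trans (concat-↭ L↭C∷R) (++⁺ʳ (concat R) (rotate-↭ xs x zs)))
    (↭-length L↭C∷R)

module _ {n c : ℕ} {ft : Placement n c} where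

  Closes-transfer : ∀ {f g : Placement n c} {t s s′} ys → g s ≡ f s′ →
    All (λ y → g y ≡ f y) ys → Closes f ft t s′ ys → Closes g ft t s ys
  Closes-transfer [] gs≡fs′ [] s′→t = trans gs≡fs′ s′→t
  Closes-transfer (y ∷ ys) gs≡fs′ (gy≡fy ∷ agree) (s′→y , rest) =
    trans gs≡fs′ s′→y , Closes-transfer ys gy≡fy agree rest

  cycles-transfer : ∀ {f g : Placement n c} R → All (λ y → g y ≡ f y) (concat R) →
    All (IsCycle f ft) R → All (IsCycle g ft) R
  cycles-transfer [] _ [] = []
  cycles-transfer ((x ∷ xs) ∷ R) (gx≡fx ∷ agree) (cyc ∷ cycs) =
    Closes-transfer xs gx≡fx (All.++⁻ˡ xs agree) cyc ∷ cycles-transfer R (All.++⁻ʳ xs agree) cycs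

  selfLoopCover : ∀ {f : Placement n c} → (∀ w → f w ≡ ft w) → CycleCover f ft
  selfLoopCover {f} f≡ft = record
    { cycles = map [_] (allFin n)
    ; areCycles = selfLoops (allFin n)
    ; partition = ↭-reflexive (concat-singletons (allFin n))
    }
    where
    selfLoops : ∀ xs → All (IsCycle f ft) (map [_] xs)
    selfLoops [] = []
    selfLoops (x ∷ xs) = f≡ft x ∷ selfLoops xs

    concat-singletons : ∀ {A : Set} (xs : List A) → concat (map [_] xs) ≡ xs
    concat-singletons [] = refl
    concat-singletons (x ∷ xs) = cong (x ∷_) (concat-singletons xs)

  numCycles-selfLoopCover : ∀ {f : Placement n c} (f≡ft : ∀ w → f w ≡ ft w) →
    numCycles (selfLoopCover f≡ft) ≡ n
  numCycles-selfLoopCover _ = trans (length-map [_] (allFin n)) (length-tabulate (λ i → i))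

module _ {n c : ℕ} (f ft : Placement n c) {a b : Fin n} (a≢b : a ≢ b) where

  private
    f′ : Placement n c
    f′ = swapAt f a b

    Agree : List (Fin n) → Set
    Agree = All (λ y → f y ≡ f′ y)

  agree-off-swap : ∀ {ys} → Unique (a ∷ b ∷ ys) → Agree ys
  agree-off-swap ((_ ∷ a∉ys) ∷ b∉ys ∷ _) =
    zipWith (λ (a≢y , b≢y) → sym (swapAt-other f a≢y b≢y)) (a∉ys , b∉ys)

  module _ {xs ys zs} (layout : a ∷ xs ++ b ∷ ys ++ zs ↭ allFin n) where

    unique-layout : Unique (a ∷ b ∷ xs ++ ys ++ zs)
    unique-layout = Unique-resp-↭ (↭-trans (↭-sym layout) (prep a (shift b xs (ys ++ zs)))) (allFin⁺ n)

    agree-layout : Agree xs × Agree ys × Agree zs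
    agree-layout with All.++⁻ xs (agree-off-swap unique-layout)
    ... | agree-xs , agree-ys++zs with All.++⁻ ys agree-ys++zs
    ...   | agree-ys , agree-zs = agree-xs , agree-ys , agree-zs

    exchange-layout : a ∷ ys ++ b ∷ xs ++ zs ↭ allFin n
    exchange-layout = ↭-trans (prep a (exchange-↭ b ys xs zs)) layout

  split-cycle : ∀ xs ys R → IsCycle f′ ft (a ∷ xs ++ b ∷ ys) → All (IsCycle f′ ft) R →
    a ∷ xs ++ b ∷ ys ++ concat R ↭ allFin n → CycleCover f ft
  split-cycle xs ys R cyc cycs layout =
    let a→b , b→a = Closes-++⁻ xs ys cyc
        agree-xs , agree-ys , agree-R = agree-layout layout
    in record
      { cycles = (a ∷ ys) ∷ (b ∷ xs) ∷ R
      ; areCycles = Closes-transfer ys (sym (swapAt-right f a≢b)) agree-ys b→a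
                  ∷ Closes-transfer xs (sym (swapAt-left f a b)) agree-xs a→b
                  ∷ cycles-transfer R agree-R cycs
      ; partition = exchange-layout layout
      }

  merge-cycles : ∀ xs ys R → IsCycle f′ ft (a ∷ xs) → IsCycle f′ ft (b ∷ ys) →
    All (IsCycle f′ ft) R → a ∷ xs ++ b ∷ ys ++ concat R ↭ allFin n → CycleCover f ft
  merge-cycles xs ys R a-cycle b-cycle cycs layout =
    let agree-xs , agree-ys , agree-R = agree-layout layout
    in record
      { cycles = (a ∷ ys ++ b ∷ xs) ∷ R
      ; areCycles = Closes-++⁺ ys xs
                      (Closes-transfer ys (sym (swapAt-right f a≢b)) agree-ys b-cycle)
                      (Closes-transfer xs (sym (swapAt-left f a b)) agree-xs a-cycle)
                  ∷ cycles-transfer R agree-R cycs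
      ; partition = ↭-trans (↭-reflexive (cong (a ∷_) (++-assoc ys (b ∷ xs) (concat R))))
                            (exchange-layout layout)
      }

  swap-step : (C : CycleCover f′ ft) → Σ (CycleCover f ft) λ C₀ → numCycles C ≤ suc (numCycles C₀)
  swap-step C = from-cycle-through-a (cycle-through cycles areCycles (∈-cover a))
    where
    open CycleCover C

    ∈-cover : ∀ x → x ∈ concat cycles
    ∈-cover x = ∈-resp-↭ (↭-sym partition) (∈-allFin x)

    from-cycle-through-a : CycleThrough a cycles →
      Σ (CycleCover f ft) λ C₀ → length cycles ≤ suc (numCycles C₀)
    from-cycle-through-a (cycleThrough xs R cyc cycs split count)
      with ∈-resp-↭ split (∈-cover b)
    ... | here b≡a = ⊥-elim (a≢b (sym b≡a))
    ... | there b∈xs++R with ∈-++⁻ xs b∈xs++R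
    ...   | inj₁ b∈xs with ∈-∃++ b∈xs
    ...     | ys , zs , refl =
      split-cycle ys zs R cyc cycs layout , ≤-trans (≤-reflexive count) (≤-trans (n≤1+n _) (n≤1+n _))
      where
      layout : a ∷ ys ++ b ∷ zs ++ concat R ↭ allFin n
      layout = ↭-trans (↭-reflexive (cong (a ∷_) (sym (++-assoc ys (b ∷ zs) (concat R)))))
                       (↭-trans (↭-sym split) partition)
    from-cycle-through-a (cycleThrough xs R cyc cycs split count) | there _ | inj₂ b∈R
      with cycle-through R cycs b∈R
    ... | cycleThrough ys R′ cyc′ cycs′ split′ count′ =
      merge-cycles xs ys R′ cyc cyc′ cycs′ layout , ≤-reflexive (trans count (cong suc count′))
      where
      layout : a ∷ xs ++ b ∷ ys ++ concat R′ ↭ allFin n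
      layout = ↭-trans (prep a (++⁺ˡ xs (↭-sym split′))) (↭-trans (↭-sym split) partition)

cover-after-swaps : ∀ {n c} (f ft : Placement n c) (es : List (Edge n)) →
  (∀ w → applySwaps f es w ≡ ft w) → Σ (CycleCover f ft) λ C → n ≤ length es + numCycles C
cover-after-swaps f ft [] f≡ft = selfLoopCover f≡ft , ≤-reflexive (sym (numCycles-selfLoopCover f≡ft))
cover-after-swaps {n} f ft ((u , v , u≢v) ∷ es) reach with cover-after-swaps (swapAt f u v) ft es reach
... | C′ , bound with swap-step f ft u≢v C′
...   | C , fewer = C , (begin
  n                             ≤⟨ bound ⟩
  length es + numCycles C′      ≤⟨ +-monoʳ-≤ (length es) fewer ⟩
  length es + suc (numCycles C) ≡⟨ +-suc (length es) (numCycles C) ⟩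
  suc (length es + numCycles C) ∎)
  where open ≤-Reasoning

lemma7 : ∀ {n c} (f0 ft : Placement n c) → IsSurjective f0 → IsSurjective ft →
    (C : CycleCover f0 ft) → IsOptimal C →
    (k : ℕ) → IsOPT f0 ft k → n ∸ numCycles C ≤ k
lemma7 {n} f0 ft _ _ C optimal k ((es , length≡k , reach) , _) with cover-after-swaps f0 ft es reach
... | C′ , bound = m≤n+o⇒m∸n≤o n (numCycles C) (begin
  n                         ≤⟨ bound ⟩
  length es + numCycles C′  ≤⟨ +-monoʳ-≤ (length es) (optimal C′) ⟩
  length es + numCycles C   ≡⟨ cong (_+ numCycles C) length≡k ⟩
  k + numCycles C           ≡⟨ +-comm k (numCycles C) ⟩
  numCycles C + k           ∎)
  where open ≤-Reasoning
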